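{- There is a quasi-filter model $\mathcal{M}=\langle S,N,V\rangle$ that has no pointwise equivalent Kripke model; that is, there is no Kripke model $\mathcal{M}'$ with domain $S$ such that for every $s\in S$ and every $\phi\in\mathcal{L}_\Delta$, $\mathcal{M}',s\vDash\phi$ iff $\mathcal{M},s\Vvdash\phi$.
   Context: $\mathcal{L}_\Delta$: $\phi::=p\mid\neg\phi\mid(\phi\land\phi)\mid\Delta\phi$ over a countable set of propositional variables. Neighborhood semantics $\Vvdash$ on $\langle S,N,V\rangle$: atoms via $V$, Boolean clauses standard, $s\Vvdash\Delta\phi$ iff $\{t:t\Vvdash\phi\}\in N(s)$. Kripke semantics on $\langle S,R,V\rangle$: $s\vDash\Delta\phi$ iff for all $t,u$ with $sRt,sRu$, ($t\vDash\phi$ iff $u\vDash\phi$). A quasi-filter model is a neighborhood model such that for every $s$: $S\in N(s)$; $X,Y\in N(s)\Rightarrow X\cap Y\in N(s)$; $X\in N(s)\Rightarrow S\setminus X\in N(s)$; and for all $X,Y,Z\subseteq S$, $X\in N(s)$ implies $X\cup Y\in N(s)$ or $(S\setminus X)\cup Z\in N(s)$. -}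

module Defs where

open import Level using (Level; 0ℓ) renaming (suc to lsuc)
open import Data.Nat using (ℕ)
open import Data.Product using (Σ; _×_; _,_)
open import Data.Sum using (_⊎_)
open import Data.Empty using (⊥)
open import Relation.Nullary using (¬_)
open import Function.Bundles using (_⇔_)

data Form : Set where
  var  : ℕ → Form
  ¬'_  : Form → Form
  _∧'_ : Form → Form → Form
  Δ    : Form → Form

Subset : Set → Set₁
Subset S = S → Set

_⊆_ : {S : Set} → Subset S → Subset S → Set
X ⊆ Y = ∀ t → X t → Y t

_∩_ : {S : Set} → Subset S → Subset S → Subset S
(X ∩ Y) t = X t × Y t

_∪_ : {S : Set} → Subset S → Subset S → Subset S
(X ∪ Y) t = X t ⊎ Y t

∁ : {S : Set} → Subset S → Subset S
∁ X t = ¬ X t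

Full : {S : Set} → Subset S
Full t = Data.Unit.⊤ where import Data.Unit

-- Neighborhood model <S, N, V>.  Since subsets are predicates, we require
-- that each N(s) is extensional (respects equality of subsets), so that
-- N(s) really is a family of subsets of S.
record NbhdModel (S : Set) : Set₁ where
  field
    N    : S → Subset S → Set
    V    : ℕ → Subset S
    N-ext : ∀ s {X Y} → X ⊆ Y → Y ⊆ X → N s X → N s Y

module _ {S : Set} (M : NbhdModel S) where
  open NbhdModel M
  infix 4 _⊩_
  _⊩_ : S → Form → Set
  s ⊩ var p   = V p s
  s ⊩ ¬' φ    = ¬ (s ⊩ φ)
  s ⊩ φ ∧' ψ  = (s ⊩ φ) × (s ⊩ ψ)
  s ⊩ Δ φ     = N s (λ t → t ⊩ φ)

record IsQuasiFilter {S : Set} (M : NbhdModel S) : Set₁ where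
  open NbhdModel M
  field
    full   : ∀ s → N s Full
    inter  : ∀ s X Y → N s X → N s Y → N s (X ∩ Y)
    compl  : ∀ s X → N s X → N s (∁ X)
    split  : ∀ s X Y Z → N s X → N s (X ∪ Y) ⊎ N s (∁ X ∪ Z)

record KripkeModel (S : Set) : Set₁ where
  field
    R : S → S → Set
    V : ℕ → Subset S

module _ {S : Set} (M : KripkeModel S) where
  open KripkeModel M
  infix 4 _⊨_
  _⊨_ : S → Form → Set
  s ⊨ var p   = V p s
  s ⊨ ¬' φ    = ¬ (s ⊨ φ)
  s ⊨ φ ∧' ψ  = (s ⊨ φ) × (s ⊨ ψ)
  s ⊨ Δ φ     = ∀ t u → R s t → R s u → (t ⊨ φ ⇔ u ⊨ φ)

PointwiseEquiv : {S : Set} → KripkeModel S → NbhdModel S → Set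
PointwiseEquiv K M = ∀ s φ → (_⊨_ K s φ ⇔ _⊩_ M s φ)

-- The neighbourhoods of every point are the eventually constant subsets of ℕ:
-- those that eventually contain, or eventually avoid, all numbers.  For any
-- filter F, the sets X with X ∈ F or ∁ X ∈ F form a quasi-filter.  Let p₀ hold at the even
-- numbers and p₍ₙ₊₁₎ exactly at n.  Each p₍ₙ₊₁₎ is a singleton, so Δ p₍ₙ₊₁₎ holds
-- at 0, whereas Δ p₀ fails there.  In a Kripke model, Δ p₍ₜ₊₁₎ at 0 for every t
-- forces every two successors of 0 to coincide, and then Δ φ holds at 0 for every
-- φ, including p₀.
module Submission where

open import Defs
open import Data.Product using (Σ; _×_; _,_)
open import Data.Sum using (_⊎_; inj₁; inj₂)
open import Data.Unit using (⊤; tt)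
open import Data.Nat using (ℕ; zero; suc; _≤_; _⊔_)
open import Data.Nat.Properties using (≤-refl; ≤-trans; n≤1+n; 1+n≰n; m≤m⊔n; m≤n⊔m)
open import Relation.Nullary using (¬_)
open import Function using (id)
open import Function.Bundles using (_⇔_; mk⇔; Equivalence)
open import Relation.Binary.PropositionalEquality using (_≡_; refl; sym; subst)

open Equivalence using (to; from)

∁-anti : {S : Set} {X Y : Subset S} → X ⊆ Y → ∁ Y ⊆ ∁ X
∁-anti X⊆Y t ¬Yt Xt = ¬Yt (X⊆Y t Xt)

record IsFilter {S : Set} (F : Subset S → Set) : Set₁ where
  field
    full  : F Full
    mono  : ∀ {X Y} → X ⊆ Y → F X → F Y
    inter : ∀ {X Y} → F X → F Y → F (X ∩ Y)

module FilterModel {S : Set} {F : Subset S → Set} (isFilter : IsFilter F) where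
  open IsFilter isFilter

  Decided : Subset S → Set
  Decided X = F X ⊎ F (∁ X)

  Decided-ext : ∀ {X Y} → X ⊆ Y → Y ⊆ X → Decided X → Decided Y
  Decided-ext X⊆Y Y⊆X (inj₁ FX)  = inj₁ (mono X⊆Y FX)
  Decided-ext X⊆Y Y⊆X (inj₂ F∁X) = inj₂ (mono (∁-anti Y⊆X) F∁X)

  model : (ℕ → Subset S) → NbhdModel S
  model V = record { N = λ _ → Decided ; V = V ; N-ext = λ _ → Decided-ext }

  isQuasiFilter : ∀ V → IsQuasiFilter (model V)
  isQuasiFilter _ = record
    { full  = λ _ → inj₁ full
    ; inter = λ _ _ _ → Decided-∩
    ; compl = λ _ _ → Decided-∁
    ; split = λ { _ _ _ _ (inj₁ FX)  → inj₁ (inj₁ (mono (λ _ → inj₁) FX))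
                ; _ _ _ _ (inj₂ F∁X) → inj₂ (inj₁ (mono (λ _ → inj₁) F∁X)) } }
    where
    Decided-∩ : ∀ {X Y} → Decided X → Decided Y → Decided (X ∩ Y)
    Decided-∩ (inj₁ FX)  (inj₁ FY)  = inj₁ (inter FX FY)
    Decided-∩ (inj₂ F∁X) _          = inj₂ (mono (λ { _ ¬Xt (Xt , _) → ¬Xt Xt }) F∁X)
    Decided-∩ (inj₁ _)   (inj₂ F∁Y) = inj₂ (mono (λ { _ ¬Yt (_ , Yt) → ¬Yt Yt }) F∁Y)

    Decided-∁ : ∀ {X} → Decided X → Decided (∁ X)
    Decided-∁ (inj₁ FX)  = inj₂ (mono (λ _ Xt ¬Xt → ¬Xt Xt) FX)
    Decided-∁ (inj₂ F∁X) = inj₁ F∁X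

Eventually : Subset ℕ → Set
Eventually P = Σ ℕ λ k → ∀ t → k ≤ t → P t

Eventually-isFilter : IsFilter Eventually
Eventually-isFilter = record
  { full  = 0 , λ _ _ → tt
  ; mono  = λ { P⊆Q (k , P≥k) → k , λ t k≤t → P⊆Q t (P≥k t k≤t) }
  ; inter = λ { (k , P≥k) (l , Q≥l) → k ⊔ l , λ t k⊔l≤t →
                  P≥k t (≤-trans (m≤m⊔n k l) k⊔l≤t) , Q≥l t (≤-trans (m≤n⊔m k l) k⊔l≤t) } }

open FilterModel Eventually-isFilter using (Decided; model; isQuasiFilter)

Alternating : Subset ℕ → Set
Alternating X = ∀ t → X (suc t) ⇔ (¬ X t)

Alternating⇒¬Decided : ∀ {X} → Alternating X → ¬ Decided X
Alternating⇒¬Decided alt (inj₁ (k , X≥k))  = to (alt k) (X≥k (suc k) (n≤1+n k)) (X≥k k ≤-refl)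
Alternating⇒¬Decided alt (inj₂ (k , ∁X≥k)) = ∁X≥k (suc k) (n≤1+n k) (from (alt k) (∁X≥k k ≤-refl))

Even : Subset ℕ
Even zero    = ⊤
Even (suc n) = ¬ Even n

Even-alternating : Alternating Even
Even-alternating _ = mk⇔ id id

singleton-decided : ∀ n → Decided (_≡ n)
singleton-decided n = inj₂ (suc n , λ { t n<t refl → 1+n≰n n<t })

valuation : ℕ → Subset ℕ
valuation zero    = Even
valuation (suc n) = _≡ n

module _ {S : Set} (K : KripkeModel S) where
  open KripkeModel K

  Δ-valid-if-successor-unique : ∀ {s} → (∀ t u → R s t → R s u → t ≡ u) → ∀ φ → _⊨_ K s (Δ φ)
  Δ-valid-if-successor-unique unique φ t u Rst Rsu =
    subst (λ w → _⊨_ K t φ ⇔ _⊨_ K w φ) (unique t u Rst Rsu) (mk⇔ id id)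

  successor-unique-if-Δ-nominals : ∀ {s} (χ : S → Form) →
    (∀ t → _⊨_ K t (χ t)) → (∀ t u → _⊨_ K u (χ t) → u ≡ t) →
    (∀ t → _⊨_ K s (Δ (χ t))) → ∀ t u → R s t → R s u → t ≡ u
  successor-unique-if-Δ-nominals χ χ-self χ-unique Δχ t u Rst Rsu =
    sym (χ-unique t u (to (Δχ t t u Rst Rsu) (χ-self t)))

proposition12 : Σ Set λ S → Σ (NbhdModel S) λ M →
    IsQuasiFilter M × ¬ (Σ (KripkeModel S) λ K → PointwiseEquiv K M)
proposition12 = ℕ , model valuation , isQuasiFilter valuation , no-equivalent-Kripke-model
  where
  no-equivalent-Kripke-model : ¬ (Σ (KripkeModel ℕ) λ K → PointwiseEquiv K (model valuation))
  no-equivalent-Kripke-model (K , K≈M) =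
    Alternating⇒¬Decided Even-alternating (to (K≈M 0 (Δ (var 0))) Δp₀)
    where
    nominal : ℕ → Form
    nominal t = var (suc t)

    Δp₀ : _⊨_ K 0 (Δ (var 0))
    Δp₀ = Δ-valid-if-successor-unique K
            (successor-unique-if-Δ-nominals K nominal
              (λ t → from (K≈M t (nominal t)) refl)
              (λ t u → to (K≈M u (nominal t)))
              (λ t → from (K≈M 0 (Δ (nominal t))) (singleton-decided t)))
            (var 0)
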